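{- Let $k\ge1$ be an integer and let $\{A_n\}_{n\ge1}$ be a sequence of integers. Define $$B_n=\frac1{n^k}\sum_{d\mid n}\mu\Big(\frac nd\Big)A_d,\qquad n=1,2,\dots,$$ where $\mu$ is the Möbius function. The following are equivalent: (i) $B_n\in\mathbb Z$ for all $n\ge1$ (i.e. $\{A_n\}$ is $k$-realizable); (ii) $A_{mp^r}\equiv A_{mp^{r-1}}\pmod{p^{rk}}$ for every prime $p$, every integer $r\ge1$ and every positive integer $m$ with $\gcd(m,p)=1$; (iii) there exist integers $B_1,B_2,\dots$ such that $\sum_{n\ge1}\frac{A_n}{n^k}z^n=\sum_{n\ge1}B_n\,\mathrm{Li}_k(z^n)$ as formal power series, where $\mathrm{Li}_k(x)=\sum_{m\ge1}x^m/m^k$. -}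

module Defs where

open import Data.Nat as ℕ using (ℕ; zero; suc; _^_; _≤_; _∸_)
open import Data.Nat.Divisibility using (_∣?_)
open import Data.Nat.Primality using (prime?)
open import Data.Integer as ℤ using (ℤ; +_)
open import Data.Rational as ℚ using (ℚ; 0ℚ)
open import Data.List using (List; filter; map; foldr; length; upTo)
open import Relation.Nullary using (¬_)
open import Relation.Nullary.Decidable using (¬?)
open import Data.List.Relation.Unary.All using (all?)
open import Data.Bool using (if_then_else_)
open import Relation.Nullary.Decidable using (does)

range1 : ℕ → List ℕ
range1 n = map suc (upTo n)

-- Natural-number quotient, with the (never used) convention n ÷ 0 = 0.
_div_ : ℕ → ℕ → ℕ
n div zero    = 0
n div (suc d) = n ℕ./ suc d

-- Rational z / d, with the (never used) convention z / 0 = 0.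
_divℚ_ : ℤ → ℕ → ℚ
z divℚ zero    = 0ℚ
z divℚ (suc d) = z ℚ./ suc d

sumℤ : List ℤ → ℤ
sumℤ = foldr ℤ._+_ (+ 0)

sumℚ : List ℚ → ℚ
sumℚ = foldr ℚ._+_ 0ℚ

divisors : ℕ → List ℕ
divisors n = filter (λ d → d ∣? n) (range1 n)

Σ∣ : ℕ → (ℕ → ℤ) → ℤ
Σ∣ n f = sumℤ (map f (divisors n))

squarefree? : ℕ → Data.Bool.Bool
squarefree? n = does (all? (λ d → ¬? ((d ℕ.* d) ∣? n)) (filter (λ d → 2 ℕ.≤? d) (range1 n)))

ω : ℕ → ℕ
ω n = length (filter (λ p → prime? p) (divisors n))

μ : ℕ → ℤ
μ n = if squarefree? n then (ℤ.- (+ 1)) ℤ.^ ω n else + 0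

Bseq : ℕ → (ℕ → ℤ) → ℕ → ℚ
Bseq k A n = (Σ∣ n (λ d → μ (n div d) ℤ.* A d)) divℚ (n ^ k)

Realizable : ℕ → (ℕ → ℤ) → Set
Realizable k A = ∀ n → 1 ≤ n → Data.Product.Σ ℤ (λ z → Bseq k A n Relation.Binary.PropositionalEquality.≡ ℚ._/_ z 1)
  where import Data.Product
        import Relation.Binary.PropositionalEquality

Congruences : ℕ → (ℕ → ℤ) → Set
Congruences k A = ∀ p r m → Data.Nat.Primality.Prime p → 1 ≤ r → 1 ≤ m → Data.Nat.GCD.gcd m p ≡ 1 →
  (+ (p ^ (r ℕ.* k))) Data.Integer.Divisibility.∣ (A (m ℕ.* p ^ r) ℤ.- A (m ℕ.* p ^ (r ∸ 1)))
  where import Data.Nat.GCD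
        import Data.Integer.Divisibility
        open import Relation.Binary.PropositionalEquality using (_≡_)

-- Formal power series over ℚ in one variable z, given by coefficients: f = Σ_N f(N) z^N.
FPS : Set
FPS = ℕ → ℚ

Li : ℕ → FPS
Li k zero    = 0ℚ
Li k (suc m) = (+ 1) divℚ (suc m ^ k)

-- f(z^n), for n ≥ 1: coefficient of z^N is f(N/n) if n ∣ N, else 0
substPow : ℕ → FPS → FPS
substPow n f N = if does (n ∣? N) then f (N div n) else 0ℚ

-- Σ_{n ≥ 1} F n, for a family with F n of z-adic order ≥ n (so the sum is
-- locally finite): the coefficient of z^N is Σ_{n=1}^{N} (F n)(N).
ΣFPS : (ℕ → FPS) → FPS
ΣFPS F N = sumℚ (map (λ n → F n N) (range1 N))

lhsSeries : ℕ → (ℕ → ℤ) → FPS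
lhsSeries k A zero    = 0ℚ
lhsSeries k A (suc n) = A (suc n) divℚ (suc n ^ k)

rhsSeries : ℕ → (ℕ → ℤ) → FPS
rhsSeries k B = ΣFPS (λ n N → (B n ℚ./ 1) ℚ.* substPow n (Li k) N)

LiExpansion : ℕ → (ℕ → ℤ) → Set
LiExpansion k A = Data.Product.Σ (ℕ → ℤ) (λ B → ∀ N → lhsSeries k A N ≡ rhsSeries k B N)
  where import Data.Product
        open import Relation.Binary.PropositionalEquality using (_≡_)

module Submission where

open import Defs
open import Data.Bool using (true; false; if_then_else_)
open import Data.Empty using (⊥-elim)
open import Data.Integer as ℤ using (ℤ; +_; _+_; _*_; -_; _-_)
import Data.Integer.Divisibility.Signed as ℤD
import Data.Integer.Properties as ℤP
open import Algebra.Properties.AbelianGroup ℤP.+-0-abelianGroup using () renaming (∙-cancelˡ to +-cancelˡ)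
open import Data.Integer.Tactic.RingSolver using (solve-∀)
open import Data.List using ([]; _∷_; _++_; [_]; filter; map; length; upTo)
open import Data.List.Membership.Propositional using (_∈_)
open import Data.List.Membership.Propositional.Properties using (∈-map⁺; ∈-upTo⁺; ∈-filter⁺; ∈-filter⁻)
import Data.List.Properties as List
open import Data.List.Relation.Unary.All as All using (All)
open import Data.Nat as ℕ using (ℕ; zero; suc; _≤_; _<_; z≤n; s≤s; _^_; NonZero; _≟_)
open import Data.Nat.Coprimality using (Coprime; coprime-divisor; gcd≡1⇒coprime; coprime⇒gcd≡1)
open import Data.Nat.Divisibility as ℕD using (_∣_; _∣?_; divides)
open import Data.Nat.DivMod using (m*n/n≡m)
open import Data.Nat.Induction using (<-rec)
open import Data.Nat.ListAction using (product)
open import Data.Nat.Primality using (Prime; prime?; prime⇒nonZero; prime⇒nonTrivial; prime⇒irreducible; euclidsLemma)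
open import Data.Nat.Primality.Factorisation using (factorise; module PrimeFactorisation)
import Data.Nat.Properties as ℕP
import Data.Nat.Tactic.RingSolver as NS
open import Data.Product using (Σ; _,_; _×_; ∃-syntax; ∃₂)
open import Data.Rational as ℚ using (ℚ; toℚᵘ)
import Data.Rational.Properties as ℚP
open import Data.Rational.Unnormalised using (mkℚᵘ; *≡*) renaming (_≃_ to _≃ᵘ_; _/_ to _/ᵘ_; _+_ to _+ᵘ_; _*_ to _*ᵘ_)
import Data.Rational.Unnormalised.Properties as ℚᵘP
open ℚᵘP using () renaming (≃-trans to ≃ᵘ-trans; ≃-sym to ≃ᵘ-sym; module ≃-Reasoning to ≃ᵘ-Reasoning)
open import Data.Sum using (inj₁; inj₂; [_,_]′)
open import Function using (id; _∘_)
open import Function.Bundles using (_⇔_; mk⇔; Equivalence)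
import Function.Properties.Equivalence as ⇔
open import Relation.Binary.PropositionalEquality hiding ([_])
open import Relation.Nullary using (Dec; yes; no; ¬_; does)
open import Relation.Nullary.Decidable using (¬?; does-⇔; dec-false)

-- Everything is reduced to the integer numerators (μ⋆A)(n) = n^k B_n.  Möbius
-- inversion A(N) = Σ_{d∣N} (μ⋆A)(d) is proved by induction along a splitting
-- N = m p^{s+1} with p ∤ m: the divisors of m p^{s+1} are those of m p^s together
-- with the e p^{s+1}, e ∣ m, and μ enters only through μ(x p) = −μ(x) and
-- μ(x p²) = 0.  The same splitting gives
--   A(m p^{s+1}) − A(m p^s) = Σ_{e∣m} (μ⋆A)(e p^{s+1}),
-- so (i) gives (ii) termwise, and conversely (ii) shows, by induction on n, that
-- every prime-power part p^{(s+1)k} of n^k divides (μ⋆A)(n).  Comparing the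
-- coefficients of z^N, (iii) says A(N) = Σ_{d∣N} d^k B_d, and by uniqueness of
-- Möbius inversion this means exactly B_d = (μ⋆A)(d) / d^k.

1≤*⇒1≤ˡ : ∀ a {b} → 1 ≤ a ℕ.* b → 1 ≤ a
1≤*⇒1≤ˡ (suc _) _ = s≤s z≤n

1≤*⇒1≤ʳ : ∀ a {b} → 1 ≤ a ℕ.* b → 1 ≤ b
1≤*⇒1≤ʳ a {b} 1≤ab = 1≤*⇒1≤ˡ b (subst (1 ≤_) (ℕP.*-comm a b) 1≤ab)

div-cancel : ∀ {n} c d .{{_ : NonZero d}} → n ≡ c ℕ.* d → n div d ≡ c
div-cancel c (suc d) refl = m*n/n≡m c (suc d)

^-distribʳ-* : ∀ a b k → (a ℕ.* b) ^ k ≡ a ^ k ℕ.* b ^ k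
^-distribʳ-* a b zero    = refl
^-distribʳ-* a b (suc k) = trans (cong (a ℕ.* b ℕ.*_) (^-distribʳ-* a b k)) (interchange a b (a ^ k) (b ^ k))
  where
  interchange : ∀ a b x y → a ℕ.* b ℕ.* (x ℕ.* y) ≡ a ℕ.* x ℕ.* (b ℕ.* y)
  interchange = NS.solve-∀

[m*p^r]^k≡m^k*p^[r*k] : ∀ m p r k → (m ℕ.* p ^ r) ^ k ≡ m ^ k ℕ.* p ^ (r ℕ.* k)
[m*p^r]^k≡m^k*p^[r*k] m p r k = trans (^-distribʳ-* m (p ^ r) k) (cong (m ^ k ℕ.*_) (ℕP.^-*-assoc p r k))

p^[r*k]∣[e*p^r]^k : ∀ e p r k → + (p ^ (r ℕ.* k)) ℤD.∣ + ((e ℕ.* p ^ r) ^ k)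
p^[r*k]∣[e*p^r]^k e p r k = ℤD.∣ᵤ⇒∣ (subst (p ^ (r ℕ.* k) ∣_) (sym ([m*p^r]^k≡m^k*p^[r*k] e p r k)) (ℕD.n∣m*n (e ^ k)))

¬prime-* : ∀ {a b} → 1 < a → 1 < b → ¬ Prime (a ℕ.* b)
¬prime-* {a} {b} 1<a 1<b ab-prime with prime⇒irreducible ab-prime (ℕD.m∣m*n b)
... | inj₁ a≡1  = ℕP.<-irrefl (sym a≡1) 1<a
... | inj₂ a≡ab = ℕP.<-irrefl a≡ab (ℕP.m<m*n a b {{ℕ.>-nonZero (ℕP.<⇒≤ 1<a)}} 1<b)

-- Sums over 1, …, n and over the divisors of n

when : {P : Set} → Dec P → ℤ → ℤ
when P? x = if does P? then x else + 0

when-yes : {P : Set} (P? : Dec P) (x : ℤ) → P → when P? x ≡ x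
when-yes (yes _) x _ = refl
when-yes (no ¬p) x p = ⊥-elim (¬p p)

when-no : {P : Set} (P? : Dec P) (x : ℤ) → ¬ P → when P? x ≡ + 0
when-no (yes p) x ¬p = ⊥-elim (¬p p)
when-no (no _)  x _  = refl

sumTo : ℕ → (ℕ → ℤ) → ℤ
sumTo zero    f = + 0
sumTo (suc n) f = sumTo n f + f (suc n)

sumTo-cong : ∀ n {f g : ℕ → ℤ} → (∀ d → 1 ≤ d → d ≤ n → f d ≡ g d) → sumTo n f ≡ sumTo n g
sumTo-cong zero    eq = refl
sumTo-cong (suc n) eq =
  cong₂ _+_ (sumTo-cong n (λ d 1≤d d≤n → eq d 1≤d (ℕP.m≤n⇒m≤1+n d≤n))) (eq (suc n) (s≤s z≤n) ℕP.≤-refl)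

sumTo-+ : ∀ n f g → sumTo n (λ d → f d + g d) ≡ sumTo n f + sumTo n g
sumTo-+ zero    f g = refl
sumTo-+ (suc n) f g =
  trans (cong (_+ (f (suc n) + g (suc n))) (sumTo-+ n f g)) (interchange (sumTo n f) (sumTo n g) (f (suc n)) (g (suc n)))
  where
  interchange : ∀ a b c d → (a + b) + (c + d) ≡ (a + c) + (b + d)
  interchange = solve-∀

sumTo-extend : ∀ n M f → n ≤ M → (∀ d → n < d → d ≤ M → f d ≡ + 0) → sumTo M f ≡ sumTo n f
sumTo-extend n zero    f z≤n _ = refl
sumTo-extend n (suc M) f n≤M vanish with n ≟ suc M
... | yes refl = refl
... | no n≢M   = begin
  sumTo M f + f (suc M) ≡⟨ cong₂ _+_ (sumTo-extend n M f (ℕP.<⇒≤pred n<M) (λ d n<d d≤M → vanish d n<d (ℕP.m≤n⇒m≤1+n d≤M)))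
                                      (vanish (suc M) n<M ℕP.≤-refl) ⟩
  sumTo n f + + 0       ≡⟨ ℤP.+-identityʳ _ ⟩
  sumTo n f             ∎
  where
  open ≡-Reasoning
  n<M = ℕP.≤∧≢⇒< n≤M n≢M

sumTo-divisible : ∀ n c f → (∀ d → 1 ≤ d → d ≤ n → c ℤD.∣ f d) → c ℤD.∣ sumTo n f
sumTo-divisible zero    c f _ = ℤD.divides (+ 0) refl
sumTo-divisible (suc n) c f c∣f =
  ℤD.∣m∣n⇒∣m+n (sumTo-divisible n c f (λ d 1≤d d≤n → c∣f d 1≤d (ℕP.m≤n⇒m≤1+n d≤n))) (c∣f (suc n) (s≤s z≤n) ℕP.≤-refl)

sumTo-multiples : ∀ q .{{_ : NonZero q}} M (h : ℕ → ℤ) →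
                  sumTo (M ℕ.* q) (λ d → when (q ∣? d) (h d)) ≡ sumTo M (λ e → h (e ℕ.* q))
sumTo-multiples (suc q) zero    h = refl
sumTo-multiples (suc q) (suc M) h = begin
  sumTo (q ℕ.+ M ℕ.* suc q) F + F (suc M ℕ.* suc q)
    ≡⟨ cong₂ _+_ (sumTo-extend (M ℕ.* suc q) _ F (ℕP.m≤n+m _ q) gap) (when-yes (suc q ∣? _) _ (ℕD.n∣m*n (suc M))) ⟩
  sumTo (M ℕ.* suc q) F + h (suc M ℕ.* suc q)
    ≡⟨ cong (_+ h (suc M ℕ.* suc q)) (sumTo-multiples (suc q) M h) ⟩
  sumTo M (λ e → h (e ℕ.* suc q)) + h (suc M ℕ.* suc q) ∎
  where
  open ≡-Reasoning
  F = λ d → when (suc q ∣? d) (h d)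
  gap : ∀ d → M ℕ.* suc q < d → d ≤ q ℕ.+ M ℕ.* suc q → F d ≡ + 0
  gap d Mq<d d<[1+M]q = when-no (suc q ∣? d) _ λ where
    (divides c refl) → ℕP.<⇒≱ (s≤s d<[1+M]q) (ℕP.*-monoˡ-≤ (suc q) (ℕP.*-cancelʳ-< (suc q) M c Mq<d))

sumℤ-map-range1 : ∀ n f → sumℤ (map f (range1 n)) ≡ sumTo n f
sumℤ-map-range1 zero    f = refl
sumℤ-map-range1 (suc n) f = begin
  sumℤ (map f (range1 (suc n)))          ≡⟨ cong sumℤ map-range1-snoc ⟩
  sumℤ (map f (range1 n) ++ [ f (suc n) ]) ≡⟨ sumℤ-++ (map f (range1 n)) ⟩
  sumℤ (map f (range1 n)) + (f (suc n) + + 0) ≡⟨ cong₂ _+_ (sumℤ-map-range1 n f) (ℤP.+-identityʳ _) ⟩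
  sumTo n f + f (suc n)                  ∎
  where
  open ≡-Reasoning
  map-range1-snoc : map f (range1 (suc n)) ≡ map f (range1 n) ++ [ f (suc n) ]
  map-range1-snoc = trans (cong (map f ∘ map suc) (sym (List.applyUpTo-∷ʳ id n)))
                      (trans (cong (map f) (List.map-++ suc (upTo n) [ n ])) (List.map-++ f (range1 n) [ suc n ]))
  sumℤ-++ : ∀ xs {ys} → sumℤ (xs ++ ys) ≡ sumℤ xs + sumℤ ys
  sumℤ-++ []       = sym (ℤP.+-identityˡ _)
  sumℤ-++ (x ∷ xs) = trans (cong (λ s → x + s) (sumℤ-++ xs)) (sym (ℤP.+-assoc x _ _))

sumℤ-map-filter : ∀ {P : ℕ → Set} (P? : ∀ x → Dec (P x)) xs g →
                  sumℤ (map g (filter P? xs)) ≡ sumℤ (map (λ x → when (P? x) (g x)) xs)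
sumℤ-map-filter P? []       g = refl
sumℤ-map-filter P? (x ∷ xs) g with does (P? x)
... | true  = cong (λ s → g x + s) (sumℤ-map-filter P? xs g)
... | false = trans (sumℤ-map-filter P? xs g) (sym (ℤP.+-identityˡ _))

+length-filter : ∀ {P : ℕ → Set} (P? : ∀ x → Dec (P x)) xs →
                 + length (filter P? xs) ≡ sumℤ (map (λ x → when (P? x) (+ 1)) xs)
+length-filter P? []       = refl
+length-filter P? (x ∷ xs) with does (P? x)
... | true  = cong (λ s → + 1 + s) (+length-filter P? xs)
... | false = trans (+length-filter P? xs) (sym (ℤP.+-identityˡ _))

Σ∣≡sumTo : ∀ n g → Σ∣ n g ≡ sumTo n (λ d → when (d ∣? n) (g d))
Σ∣≡sumTo n g = trans (sumℤ-map-filter (_∣? n) (range1 n) g) (sumℤ-map-range1 n _)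

Σ∣-cong : ∀ n {g h : ℕ → ℤ} → (∀ d → d ∣ n → g d ≡ h d) → Σ∣ n g ≡ Σ∣ n h
Σ∣-cong n {g} {h} g≗h = trans (Σ∣≡sumTo n g) (trans (sumTo-cong n (λ d _ _ → pointwise d)) (sym (Σ∣≡sumTo n h)))
  where
  pointwise : ∀ d → when (d ∣? n) (g d) ≡ when (d ∣? n) (h d)
  pointwise d with d ∣? n
  ... | yes d∣n = g≗h d d∣n
  ... | no  _   = refl

Σ∣-+ : ∀ n g h → Σ∣ n (λ d → g d + h d) ≡ Σ∣ n g + Σ∣ n h
Σ∣-+ n g h = begin
  Σ∣ n (λ d → g d + h d)                                            ≡⟨ Σ∣≡sumTo n _ ⟩
  sumTo n (λ d → when (d ∣? n) (g d + h d))                         ≡⟨ sumTo-cong n (λ d _ _ → when-+ (d ∣? n)) ⟩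
  sumTo n (λ d → when (d ∣? n) (g d) + when (d ∣? n) (h d))         ≡⟨ sumTo-+ n _ _ ⟩
  sumTo n (λ d → when (d ∣? n) (g d)) + sumTo n (λ d → when (d ∣? n) (h d))
                                                                    ≡⟨ sym (cong₂ _+_ (Σ∣≡sumTo n g) (Σ∣≡sumTo n h)) ⟩
  Σ∣ n g + Σ∣ n h                                                   ∎
  where
  open ≡-Reasoning
  when-+ : ∀ {P : Set} (P? : Dec P) {x y} → when P? (x + y) ≡ when P? x + when P? y
  when-+ (yes _) = refl
  when-+ (no _)  = refl

Σ∣-zero : ∀ n g → (∀ d → d ∣ n → g d ≡ + 0) → Σ∣ n g ≡ + 0
Σ∣-zero n g vanish = trans (Σ∣≡sumTo n g) (sumTo-extend 0 n _ z≤n (λ d _ _ → pointwise d))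
  where
  pointwise : ∀ d → when (d ∣? n) (g d) ≡ + 0
  pointwise d with d ∣? n
  ... | yes d∣n = vanish d d∣n
  ... | no  _   = refl

Σ∣-divisible : ∀ n c g → (∀ d → d ∣ n → c ℤD.∣ g d) → c ℤD.∣ Σ∣ n g
Σ∣-divisible n c g c∣g = subst (c ℤD.∣_) (sym (Σ∣≡sumTo n g)) (sumTo-divisible n c _ (λ d _ _ → pointwise d))
  where
  pointwise : ∀ d → c ℤD.∣ when (d ∣? n) (g d)
  pointwise d with d ∣? n
  ... | yes d∣n = c∣g d d∣n
  ... | no  _   = ℤD.divides (+ 0) refl

Σ∣-last : ∀ n g → Σ∣ (suc n) g ≡ sumTo n (λ d → when (d ∣? suc n) (g d)) + g (suc n)
Σ∣-last n g = trans (Σ∣≡sumTo (suc n) g) (cong (λ x → sumTo n (λ d → when (d ∣? suc n) (g d)) + x) (when-yes (suc n ∣? suc n) _ ℕD.∣-refl))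

Σ∣-supported-at-1 : ∀ n g → 1 ≤ n → (∀ d → d ∣ n → 2 ≤ d → g d ≡ + 0) → Σ∣ n g ≡ g 1
Σ∣-supported-at-1 (suc n) g _ vanish = begin
  Σ∣ (suc n) g                                         ≡⟨ Σ∣≡sumTo (suc n) g ⟩
  sumTo (suc n) (λ d → when (d ∣? suc n) (g d))        ≡⟨ sumTo-extend 1 (suc n) _ (s≤s z≤n) (λ d 1<d _ → pointwise d 1<d) ⟩
  + 0 + when (1 ∣? suc n) (g 1)                        ≡⟨ trans (ℤP.+-identityˡ _) (when-yes (1 ∣? suc n) _ (ℕD.1∣ _)) ⟩
  g 1                                                  ∎
  where
  open ≡-Reasoning
  pointwise : ∀ d → 1 < d → when (d ∣? suc n) (g d) ≡ + 0
  pointwise d 1<d with d ∣? suc n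
  ... | yes d∣n = vanish d d∣n 1<d
  ... | no  _   = refl

Σ∣-injective : ∀ (F G : ℕ → ℤ) → (∀ N → 1 ≤ N → Σ∣ N F ≡ Σ∣ N G) → ∀ n → 1 ≤ n → F n ≡ G n
Σ∣-injective F G Σ∣F≡Σ∣G = <-rec (λ n → 1 ≤ n → F n ≡ G n) step
  where
  step : ∀ n → (∀ {y} → y < n → 1 ≤ y → F y ≡ G y) → 1 ≤ n → F n ≡ G n
  step (suc n) IH _ = +-cancelˡ (sumTo n (λ d → when (d ∣? suc n) (F d))) (F (suc n)) (G (suc n)) (begin
    sumTo n (λ d → when (d ∣? suc n) (F d)) + F (suc n) ≡⟨ sym (Σ∣-last n F) ⟩
    Σ∣ (suc n) F                                        ≡⟨ Σ∣F≡Σ∣G (suc n) (s≤s z≤n) ⟩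
    Σ∣ (suc n) G                                        ≡⟨ Σ∣-last n G ⟩
    sumTo n (λ d → when (d ∣? suc n) (G d)) + G (suc n) ≡⟨ cong (_+ G (suc n)) (sumTo-cong n (λ d 1≤d d≤n → sym (proper d 1≤d d≤n))) ⟩
    sumTo n (λ d → when (d ∣? suc n) (F d)) + G (suc n) ∎)
    where
    open ≡-Reasoning
    proper : ∀ d → 1 ≤ d → d ≤ n → when (d ∣? suc n) (F d) ≡ when (d ∣? suc n) (G d)
    proper d 1≤d d≤n with d ∣? suc n
    ... | yes _ = IH (s≤s d≤n) 1≤d
    ... | no  _ = refl

-- The Möbius function

SquareFree : ℕ → Set
SquareFree n = ∀ d → 2 ≤ d → ¬ d ℕ.* d ∣ n

squarefree-test : ∀ n → Dec (All (λ d → ¬ d ℕ.* d ∣ n) (filter (2 ℕ.≤?_) (range1 n)))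
squarefree-test n = All.all? (λ d → ¬? (d ℕ.* d ∣? n)) (filter (2 ℕ.≤?_) (range1 n))

squarefree-test⇔ : ∀ n → 1 ≤ n → All (λ d → ¬ d ℕ.* d ∣ n) (filter (2 ℕ.≤?_) (range1 n)) ⇔ SquareFree n
squarefree-test⇔ n 1≤n = mk⇔
  (λ test d 2≤d dd∣n → All.lookup test (∈-filter⁺ (2 ℕ.≤?_) (∈-range1 2≤d (d≤n 2≤d dd∣n)) 2≤d) dd∣n)
  (λ sf → All.tabulate λ d∈ → let (_ , 2≤d) = ∈-filter⁻ (2 ℕ.≤?_) {xs = range1 n} d∈ in sf _ 2≤d)
  where
  ∈-range1 : ∀ {d} → 2 ≤ d → d ≤ n → d ∈ range1 n
  ∈-range1 {suc d} _ d<n = ∈-map⁺ suc (∈-upTo⁺ d<n)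
  d≤n : ∀ {d} → 2 ≤ d → d ℕ.* d ∣ n → d ≤ n
  d≤n {d} 2≤d dd∣n = ℕP.≤-trans (ℕP.m≤m*n d d {{ℕ.>-nonZero (ℕP.<⇒≤ 2≤d)}}) (ℕD.∣⇒≤ {{ℕ.>-nonZero 1≤n}} dd∣n)

squarefree?-cong : ∀ {x y} → 1 ≤ x → 1 ≤ y → SquareFree x ⇔ SquareFree y → squarefree? x ≡ squarefree? y
squarefree?-cong {x} {y} 1≤x 1≤y x⇔y =
  does-⇔ (⇔.trans (squarefree-test⇔ x 1≤x) (⇔.trans x⇔y (⇔.sym (squarefree-test⇔ y 1≤y)))) (squarefree-test x) (squarefree-test y)

μ-non-squarefree : ∀ {x} → 1 ≤ x → ¬ SquareFree x → μ x ≡ + 0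
μ-non-squarefree {x} 1≤x ¬sf =
  cong (λ b → if b then (- + 1) ℤ.^ ω x else + 0) (dec-false (squarefree-test x) (¬sf ∘ Equivalence.to (squarefree-test⇔ x 1≤x)))

+ω≡Σ∣ : ∀ n → + ω n ≡ Σ∣ n (λ d → when (prime? d) (+ 1))
+ω≡Σ∣ n = +length-filter prime? (divisors n)

-- The numerator n^k B_n of the paper's B_n.
μ⋆ : (ℕ → ℤ) → ℕ → ℤ
μ⋆ A n = Σ∣ n (λ d → μ (n div d) * A d)

-- Splitting off a prime p

module _ {p : ℕ} (p-prime : Prime p) where

  private instance
    p≢0 : NonZero p
    p≢0 = prime⇒nonZero p-prime

  1<p : 1 < p
  1<p = ℕ.nonTrivial⇒n>1 p {{prime⇒nonTrivial p-prime}}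

  ∤⇒coprime : ∀ {d} → ¬ p ∣ d → Coprime d p
  ∤⇒coprime p∤d (i∣d , i∣p) with prime⇒irreducible p-prime i∣p
  ... | inj₁ i≡1 = i≡1
  ... | inj₂ refl = ⊥-elim (p∤d i∣d)

  ∤-^ : ∀ {m} → ¬ p ∣ m → ∀ k → ¬ p ∣ m ^ k
  ∤-^ p∤m zero    p∣1    = ℕP.<-irrefl (sym (ℕD.∣1⇒≡1 p∣1)) 1<p
  ∤-^ p∤m (suc k) p∣m^k+1 = [ p∤m , ∤-^ p∤m k ]′ (euclidsLemma _ _ p-prime p∣m^k+1)

  p^-∣-cancel : ∀ {y} → ¬ p ∣ y → ∀ j t → p ^ j ∣ t ℕ.* y → p ^ j ∣ t
  p^-∣-cancel p∤y zero    t _ = ℕD.1∣ t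
  p^-∣-cancel {y} p∤y (suc j) t p^j+1∣ty with euclidsLemma t y p-prime (ℕD.∣-trans (ℕD.m∣m*n (p ^ j)) p^j+1∣ty)
  ... | inj₂ p∣y = ⊥-elim (p∤y p∣y)
  ... | inj₁ (divides t′ refl) =
    subst (_∣ t′ ℕ.* p) (ℕP.*-comm (p ^ j) p)
      (ℕD.*-monoˡ-∣ p (p^-∣-cancel p∤y j t′ (ℕD.*-cancelˡ-∣ p (subst (p ℕ.* p ^ j ∣_) (regroup t′ p y) p^j+1∣ty))))
    where
    regroup : ∀ t p y → t ℕ.* p ℕ.* y ≡ p ℕ.* (t ℕ.* y)
    regroup = NS.solve-∀

  *-p^-∣ : ∀ {y X} j → ¬ p ∣ y → y ∣ X → p ^ j ∣ X → y ℕ.* p ^ j ∣ X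
  *-p^-∣ {y} j p∤y (divides t refl) p^j∣ty with p^-∣-cancel p∤y j t p^j∣ty
  ... | divides u refl = divides u (regroup u (p ^ j) y)
    where
    regroup : ∀ u x y → u ℕ.* x ℕ.* y ≡ u ℕ.* (y ℕ.* x)
    regroup = NS.solve-∀

  1≤*p^ : ∀ {m} j → 1 ≤ m → 1 ≤ m ℕ.* p ^ j
  1≤*p^ j 1≤m = ℕP.*-mono-≤ 1≤m (ℕP.m^n>0 p j)

  m<m*p^suc : ∀ {m} s → 1 ≤ m → m < m ℕ.* p ^ suc s
  m<m*p^suc {m} s 1≤m = ℕP.m<m*n m (p ^ suc s) {{ℕ.>-nonZero 1≤m}} (ℕP.<-≤-trans 1<p (ℕP.m≤m*n p (p ^ s) {{ℕP.m^n≢0 p s}}))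

  m*p^s<m*p^suc : ∀ {m} s → 1 ≤ m → m ℕ.* p ^ s < m ℕ.* p ^ suc s
  m*p^s<m*p^suc {m} s 1≤m = ℕP.*-monoʳ-< m {{ℕ.>-nonZero 1≤m}}
    (subst (p ^ s <_) (ℕP.*-comm (p ^ s) p) (ℕP.m<m*n (p ^ s) p {{ℕP.m^n≢0 p s}} 1<p))

  new-divisor⇒p^suc∣ : ∀ {m} s d → d ∣ m ℕ.* p ^ suc s → ¬ d ∣ m ℕ.* p ^ s → p ^ suc s ∣ d
  new-divisor⇒p^suc∣ {m} s d d∣mp^s+1 d∤mp^s with p ∣? d
  ... | no p∤d = ⊥-elim (d∤mp^s (coprime-divisor (∤⇒coprime p∤d) (subst (d ∣_) (regroup m p (p ^ s)) d∣mp^s+1)))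
    where
    regroup : ∀ m p x → m ℕ.* (p ℕ.* x) ≡ p ℕ.* (m ℕ.* x)
    regroup = NS.solve-∀
  ... | yes (divides d′ refl) = p^suc∣d′p s d∤mp^s (ℕD.*-cancelʳ-∣ p (subst (d′ ℕ.* p ∣_) (p^suc-last s) d∣mp^s+1))
    where
    p^suc-last : ∀ s → m ℕ.* p ^ suc s ≡ m ℕ.* p ^ s ℕ.* p
    p^suc-last s = trans (cong (m ℕ.*_) (ℕP.*-comm p (p ^ s))) (sym (ℕP.*-assoc m (p ^ s) p))
    p^suc∣d′p : ∀ s → ¬ d′ ℕ.* p ∣ m ℕ.* p ^ s → d′ ∣ m ℕ.* p ^ s → p ^ suc s ∣ d′ ℕ.* p
    p^suc∣d′p zero    _      _      = divides d′ (cong (d′ ℕ.*_) (sym (ℕP.*-identityʳ p)))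
    p^suc∣d′p (suc s) d′p∤ d′∣ =
      subst (_∣ d′ ℕ.* p) (ℕP.*-comm (p ^ suc s) p)
        (ℕD.*-monoˡ-∣ p (new-divisor⇒p^suc∣ {m} s d′ d′∣ λ d′∣mp^s →
          d′p∤ (subst (d′ ℕ.* p ∣_) (sym (p^suc-last s)) (ℕD.*-monoˡ-∣ p d′∣mp^s))))

  Σ∣-*p^suc : ∀ {m} → ¬ p ∣ m → 1 ≤ m → ∀ s g →
              Σ∣ (m ℕ.* p ^ suc s) g ≡ Σ∣ (m ℕ.* p ^ s) g + Σ∣ m (λ e → g (e ℕ.* p ^ suc s))
  Σ∣-*p^suc {m} p∤m 1≤m s g = begin
    Σ∣ N g                                                               ≡⟨ Σ∣≡sumTo N g ⟩
    sumTo N (λ d → when (d ∣? N) (g d))                                  ≡⟨ sumTo-cong N (λ d _ _ → split d) ⟩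
    sumTo N (λ d → when (d ∣? N') (g d) + when (q ∣? d) (h d))           ≡⟨ sumTo-+ N _ _ ⟩
    sumTo N (λ d → when (d ∣? N') (g d)) + sumTo N (λ d → when (q ∣? d) (h d))
      ≡⟨ cong₂ _+_ (sumTo-extend N' N _ N'≤N beyond) (sumTo-multiples q m h) ⟩
    sumTo N' (λ d → when (d ∣? N') (g d)) + sumTo m (λ e → h (e ℕ.* q))
      ≡⟨ cong₂ _+_ (sym (Σ∣≡sumTo N' g)) (trans (sumTo-cong m (λ e _ _ → h-multiple e)) (sym (Σ∣≡sumTo m _))) ⟩
    Σ∣ N' g + Σ∣ m (λ e → g (e ℕ.* q))                                   ∎
    where
    open ≡-Reasoning
    q  = p ^ suc s
    N  = m ℕ.* q
    N' = m ℕ.* p ^ s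
    instance
      q≢0 : NonZero q
      q≢0 = ℕP.m^n≢0 p (suc s)
      N'≢0 : NonZero N'
      N'≢0 = ℕP.m*n≢0 m (p ^ s) {{ℕ.>-nonZero 1≤m}} {{ℕP.m^n≢0 p s}}
    h : ℕ → ℤ
    h d = when ((d div q) ∣? m) (g d)
    h-multiple : ∀ e → h (e ℕ.* q) ≡ when (e ∣? m) (g (e ℕ.* q))
    h-multiple e = cong (λ c → when (c ∣? m) (g (e ℕ.* q))) (div-cancel e q refl)
    N'≤N : N' ≤ N
    N'≤N = ℕP.*-monoʳ-≤ m (ℕP.m≤n*m (p ^ s) p)
    N'∣N : N' ∣ N
    N'∣N = ℕD.*-monoʳ-∣ m (ℕD.n∣m*n p)
    q∤N' : ¬ q ∣ N'
    q∤N' q∣N' = p∤m (ℕD.*-cancelˡ-∣ (p ^ s) {{ℕP.m^n≢0 p s}}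
                       (subst₂ _∣_ (ℕP.*-comm p (p ^ s)) (ℕP.*-comm m (p ^ s)) q∣N'))
    beyond : ∀ d → N' < d → d ≤ N → when (d ∣? N') (g d) ≡ + 0
    beyond d N'<d _ = when-no (d ∣? N') _ (λ d∣N' → ℕP.<⇒≱ N'<d (ℕD.∣⇒≤ d∣N'))
    split : ∀ d → when (d ∣? N) (g d) ≡ when (d ∣? N') (g d) + when (q ∣? d) (h d)
    split d with d ∣? N' | d ∣? N | q ∣? d
    ... | yes d∣N' | _      | yes q∣d = ⊥-elim (q∤N' (ℕD.∣-trans q∣d d∣N'))
    ... | yes _    | yes _  | no _    = sym (ℤP.+-identityʳ _)
    ... | yes d∣N' | no d∤N | no _    = ⊥-elim (d∤N (ℕD.∣-trans d∣N' N'∣N))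
    ... | no d∤N'  | yes d∣N | no q∤d = ⊥-elim (q∤d (new-divisor⇒p^suc∣ {m} s d d∣N d∤N'))
    ... | no _     | yes d∣N | yes (divides c refl) =
      sym (trans (ℤP.+-identityˡ _) (trans (h-multiple c) (when-yes (c ∣? m) _ (ℕD.*-cancelʳ-∣ q d∣N))))
    ... | no _     | no d∤N | yes (divides c refl) =
      sym (trans (ℤP.+-identityˡ _) (trans (h-multiple c) (when-no (c ∣? m) _ (λ c∣m → d∤N (ℕD.*-monoˡ-∣ q c∣m)))))
    ... | no _     | no _   | no _    = refl

  squareFree-*p⇔ : ∀ {x} → ¬ p ∣ x → SquareFree (x ℕ.* p) ⇔ SquareFree x
  squareFree-*p⇔ {x} p∤x = mk⇔ (λ sf d 2≤d dd∣x → sf d 2≤d (ℕD.∣m⇒∣m*n p dd∣x)) from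
    where
    from : SquareFree x → SquareFree (x ℕ.* p)
    from sf d 2≤d dd∣xp with p ∣? d
    ... | yes (divides d' refl) =
      p∤x (ℕD.∣-trans (ℕD.n∣m*n (d' ℕ.* d')) (ℕD.*-cancelˡ-∣ p (subst₂ _∣_ (square-of-multiple d' p) (ℕP.*-comm x p) dd∣xp)))
      where
      square-of-multiple : ∀ d' p → d' ℕ.* p ℕ.* (d' ℕ.* p) ≡ p ℕ.* (d' ℕ.* d' ℕ.* p)
      square-of-multiple = NS.solve-∀
    ... | no p∤d = sf d 2≤d (coprime-divisor (∤⇒coprime p∤dd) (subst (d ℕ.* d ∣_) (ℕP.*-comm x p) dd∣xp))
      where
      p∤dd : ¬ p ∣ d ℕ.* d
      p∤dd p∣dd = [ p∤d , p∤d ]′ (euclidsLemma d d p-prime p∣dd)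

  ω-*p : ∀ {x} → ¬ p ∣ x → 1 ≤ x → ω (x ℕ.* p) ≡ suc (ω x)
  ω-*p {x} p∤x 1≤x = ℤP.+-injective (begin
    + ω (x ℕ.* p)                                    ≡⟨ +ω≡Σ∣ (x ℕ.* p) ⟩
    Σ∣ (x ℕ.* p) P                                   ≡⟨ cong (λ n → Σ∣ n P) (cong (x ℕ.*_) p≡p^1) ⟩
    Σ∣ (x ℕ.* p ^ 1) P                               ≡⟨ Σ∣-*p^suc p∤x 1≤x 0 P ⟩
    Σ∣ (x ℕ.* 1) P + Σ∣ x (λ e → P (e ℕ.* p ^ 1))   ≡⟨ cong₂ _+_ (cong (λ n → Σ∣ n P) (ℕP.*-identityʳ x))
                                                              (Σ∣-supported-at-1 x _ 1≤x composite) ⟩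
    Σ∣ x P + P (1 ℕ.* p ^ 1)                         ≡⟨ cong₂ _+_ (sym (+ω≡Σ∣ x))
                                                              (when-yes (prime? _) _ (subst Prime (trans p≡p^1 (sym (ℕP.*-identityˡ _))) p-prime)) ⟩
    + ω x + + 1                                      ≡⟨ ℤP.+-comm (+ ω x) (+ 1) ⟩
    + suc (ω x)                                      ∎)
    where
    open ≡-Reasoning
    P : ℕ → ℤ
    P d = when (prime? d) (+ 1)
    p≡p^1 : p ≡ p ^ 1
    p≡p^1 = sym (ℕP.*-identityʳ p)
    composite : ∀ e → e ∣ x → 2 ≤ e → P (e ℕ.* p ^ 1) ≡ + 0
    composite e _ 2≤e = when-no (prime? _) _ (¬prime-* 2≤e (subst (1 <_) p≡p^1 1<p))

  μ-*p : ∀ {x} → ¬ p ∣ x → 1 ≤ x → μ (x ℕ.* p) ≡ - μ x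
  μ-*p {x} p∤x 1≤x = begin
    μ (x ℕ.* p)
      ≡⟨ cong₂ (λ b w → if b then (- + 1) ℤ.^ w else + 0)
               (squarefree?-cong (ℕP.≤-trans 1≤x (ℕP.m≤m*n x p)) 1≤x (squareFree-*p⇔ p∤x)) (ω-*p p∤x 1≤x) ⟩
    (if squarefree? x then (- + 1) ℤ.* (- + 1) ℤ.^ ω x else + 0)  ≡⟨ negate-branch (squarefree? x) ⟩
    - μ x                                                          ∎
    where
    open ≡-Reasoning
    negate-branch : ∀ b → (if b then (- + 1) ℤ.* (- + 1) ℤ.^ ω x else + 0) ≡ - (if b then (- + 1) ℤ.^ ω x else + 0)
    negate-branch true  = ℤP.-1*i≡-i _
    negate-branch false = refl

  μ[e*p^suc/f*p^s] : ∀ {e f} s → f ∣ e → 1 ≤ e → ¬ p ∣ e → μ ((e ℕ.* p ^ suc s) div (f ℕ.* p ^ s)) ≡ - μ (e div f)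
  μ[e*p^suc/f*p^s] {f = f} s (divides c refl) 1≤e p∤e = begin
    μ ((c ℕ.* f ℕ.* p ^ suc s) div (f ℕ.* p ^ s)) ≡⟨ cong μ (div-cancel (c ℕ.* p) (f ℕ.* p ^ s) (regroup c f p (p ^ s))) ⟩
    μ (c ℕ.* p)                                   ≡⟨ μ-*p (λ p∣c → p∤e (ℕD.∣m⇒∣m*n f p∣c)) (1≤*⇒1≤ˡ c 1≤e) ⟩
    - μ c                                         ≡⟨ cong (-_ ∘ μ) (sym (div-cancel c f refl)) ⟩
    - μ ((c ℕ.* f) div f)                         ∎
    where
    open ≡-Reasoning
    instance
      f≢0 : NonZero f
      f≢0 = ℕ.>-nonZero (1≤*⇒1≤ʳ c 1≤e)
      fp^s≢0 : NonZero (f ℕ.* p ^ s)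
      fp^s≢0 = ℕP.m*n≢0 f (p ^ s) {{f≢0}} {{ℕP.m^n≢0 p s}}
    regroup : ∀ c f p x → c ℕ.* f ℕ.* (p ℕ.* x) ≡ c ℕ.* p ℕ.* (f ℕ.* x)
    regroup = NS.solve-∀

  μ[e*p^2+s/d]≡0 : ∀ {e d} s → d ∣ e ℕ.* p ^ s → 1 ≤ e → μ ((e ℕ.* p ^ suc (suc s)) div d) ≡ + 0
  μ[e*p^2+s/d]≡0 {e} {d} s (divides c ep^s≡cd) 1≤e = begin
    μ ((e ℕ.* p ^ suc (suc s)) div d) ≡⟨ cong μ (div-cancel (c ℕ.* (p ℕ.* p)) d e·p²·p^s≡) ⟩
    μ (c ℕ.* (p ℕ.* p))               ≡⟨ μ-non-squarefree 1≤cpp (λ sf → sf p 1<p (ℕD.n∣m*n c)) ⟩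
    + 0                               ∎
    where
    open ≡-Reasoning
    1≤cd : 1 ≤ c ℕ.* d
    1≤cd = subst (1 ≤_) ep^s≡cd (1≤*p^ s 1≤e)
    1≤cpp : 1 ≤ c ℕ.* (p ℕ.* p)
    1≤cpp = ℕP.*-mono-≤ (1≤*⇒1≤ˡ c 1≤cd) (ℕP.*-mono-≤ (ℕP.<⇒≤ 1<p) (ℕP.<⇒≤ 1<p))
    instance
      d≢0 : NonZero d
      d≢0 = ℕ.>-nonZero (1≤*⇒1≤ʳ c 1≤cd)
    e·p²·p^s≡ : e ℕ.* p ^ suc (suc s) ≡ c ℕ.* (p ℕ.* p) ℕ.* d
    e·p²·p^s≡ = trans (regroup e p (p ^ s)) (trans (cong (ℕ._* (p ℕ.* p)) ep^s≡cd) (regroup′ c d p))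
      where
      regroup : ∀ e p x → e ℕ.* (p ℕ.* (p ℕ.* x)) ≡ e ℕ.* x ℕ.* (p ℕ.* p)
      regroup = NS.solve-∀
      regroup′ : ∀ c d p → c ℕ.* d ℕ.* (p ℕ.* p) ≡ c ℕ.* (p ℕ.* p) ℕ.* d
      regroup′ = NS.solve-∀

  Σ∣[e*p^s]μ[e*p^suc/d] : ∀ {e} → 1 ≤ e → ¬ p ∣ e → ∀ s (A : ℕ → ℤ) →
                   Σ∣ (e ℕ.* p ^ s) (λ d → μ ((e ℕ.* p ^ suc s) div d) * A d)
                   ≡ Σ∣ e (λ f → - μ (e div f) * A (f ℕ.* p ^ s))
  Σ∣[e*p^s]μ[e*p^suc/d] {e} 1≤e p∤e zero A = begin
    Σ∣ (e ℕ.* 1) G                        ≡⟨ cong (λ n → Σ∣ n G) (ℕP.*-identityʳ e) ⟩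
    Σ∣ e G                                ≡⟨ Σ∣-cong e (λ f f∣e → trans (cong G (sym (ℕP.*-identityʳ f)))
                                                                      (cong (_* A (f ℕ.* 1)) (μ[e*p^suc/f*p^s] 0 f∣e 1≤e p∤e))) ⟩
    Σ∣ e (λ f → - μ (e div f) * A (f ℕ.* 1)) ∎
    where
    open ≡-Reasoning
    G : ℕ → ℤ
    G d = μ ((e ℕ.* p ^ 1) div d) * A d
  Σ∣[e*p^s]μ[e*p^suc/d] {e} 1≤e p∤e (suc s) A = begin
    Σ∣ (e ℕ.* p ^ suc s) G                                    ≡⟨ Σ∣-*p^suc p∤e 1≤e s G ⟩
    Σ∣ (e ℕ.* p ^ s) G + Σ∣ e (λ f → G (f ℕ.* p ^ suc s))     ≡⟨ cong₂ _+_ (Σ∣-zero _ G p²-divides) (Σ∣-cong e top-divisors) ⟩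
    + 0 + Σ∣ e (λ f → - μ (e div f) * A (f ℕ.* p ^ suc s))   ≡⟨ ℤP.+-identityˡ _ ⟩
    Σ∣ e (λ f → - μ (e div f) * A (f ℕ.* p ^ suc s))         ∎
    where
    open ≡-Reasoning
    G : ℕ → ℤ
    G d = μ ((e ℕ.* p ^ suc (suc s)) div d) * A d
    p²-divides : ∀ d → d ∣ e ℕ.* p ^ s → G d ≡ + 0
    p²-divides d d∣ = trans (cong (_* A d) (μ[e*p^2+s/d]≡0 s d∣ 1≤e)) (ℤP.*-zeroˡ (A d))
    top-divisors : ∀ f → f ∣ e → G (f ℕ.* p ^ suc s) ≡ - μ (e div f) * A (f ℕ.* p ^ suc s)
    top-divisors f f∣e = cong (_* A (f ℕ.* p ^ suc s)) (μ[e*p^suc/f*p^s] (suc s) f∣e 1≤e p∤e)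

  μ⋆-*p^suc : ∀ {e} → 1 ≤ e → ¬ p ∣ e → ∀ s (A : ℕ → ℤ) →
              μ⋆ A (e ℕ.* p ^ suc s) ≡ μ⋆ (λ f → A (f ℕ.* p ^ suc s) - A (f ℕ.* p ^ s)) e
  μ⋆-*p^suc {e} 1≤e p∤e s A = begin
    Σ∣ (e ℕ.* q) G                                                         ≡⟨ Σ∣-*p^suc p∤e 1≤e s G ⟩
    Σ∣ (e ℕ.* p ^ s) G + Σ∣ e (λ f → G (f ℕ.* q))                          ≡⟨ cong₂ _+_ (Σ∣[e*p^s]μ[e*p^suc/d] 1≤e p∤e s A) (Σ∣-cong e top-divisors) ⟩
    Σ∣ e (λ f → - μ (e div f) * A (f ℕ.* p ^ s)) + Σ∣ e (λ f → μ (e div f) * A (f ℕ.* q))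
                                                                           ≡⟨ sym (Σ∣-+ e _ _) ⟩
    Σ∣ e (λ f → - μ (e div f) * A (f ℕ.* p ^ s) + μ (e div f) * A (f ℕ.* q)) ≡⟨ Σ∣-cong e (λ f _ → factor-out (μ (e div f)) _ _) ⟩
    μ⋆ (λ f → A (f ℕ.* q) - A (f ℕ.* p ^ s)) e                             ∎
    where
    open ≡-Reasoning
    q = p ^ suc s
    G : ℕ → ℤ
    G d = μ ((e ℕ.* q) div d) * A d
    top-divisors : ∀ f → f ∣ e → G (f ℕ.* q) ≡ μ (e div f) * A (f ℕ.* q)
    top-divisors f (divides c refl) = cong (λ x → μ x * A (f ℕ.* q)) (trans (div-cancel c (f ℕ.* q) (ℕP.*-assoc c f q)) (sym (div-cancel c f refl)))
      where
      instance
        f≢0 : NonZero f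
        f≢0 = ℕ.>-nonZero (1≤*⇒1≤ʳ c 1≤e)
        fq≢0 : NonZero (f ℕ.* q)
        fq≢0 = ℕP.m*n≢0 f q {{f≢0}} {{ℕP.m^n≢0 p (suc s)}}
    factor-out : ∀ x a b → - x * a + x * b ≡ x * (b - a)
    factor-out = solve-∀

-- Induction along prime-power splittings

data PrimePowerSplit : ℕ → Set where
  split : ∀ {p} → Prime p → ∀ m s → ¬ p ∣ m → PrimePowerSplit (m ℕ.* p ^ suc s)

prime-divisor : ∀ n → 2 ≤ n → ∃[ p ] Prime p × p ∣ n
prime-divisor n 2≤n = from-factors factors isFactorisation factorsPrime
  where
  instance
    n≢0 : NonZero n
    n≢0 = ℕ.>-nonZero (ℕP.<⇒≤ 2≤n)
  open PrimeFactorisation (factorise n)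
  from-factors : ∀ ps → n ≡ product ps → All Prime ps → ∃[ p ] Prime p × p ∣ n
  from-factors []       n≡1 _             = ⊥-elim (ℕP.<-irrefl (sym n≡1) 2≤n)
  from-factors (p ∷ ps) n≡  (p-prime All.∷ _) = p , p-prime , divides (product ps) (trans n≡ (ℕP.*-comm p _))

p-adic-split : ∀ {p} → Prime p → ∀ n → 1 ≤ n → p ∣ n → ∃₂ λ m s → ¬ p ∣ m × n ≡ m ℕ.* p ^ suc s
p-adic-split {p} p-prime = <-rec (λ n → 1 ≤ n → p ∣ n → Split n) step
  where
  Split : ℕ → Set
  Split n = ∃₂ λ m s → ¬ p ∣ m × n ≡ m ℕ.* p ^ suc s
  step : ∀ n → (∀ {c} → c < n → 1 ≤ c → p ∣ c → Split c) → 1 ≤ n → p ∣ n → Split n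
  step n IH 1≤n (divides c refl) with p ∣? c
  ... | no p∤c = c , 0 , p∤c , cong (c ℕ.*_) (sym (ℕP.*-identityʳ p))
  ... | yes p∣c with IH (ℕP.m<m*n c p {{ℕ.>-nonZero 1≤c′}} (1<p p-prime)) 1≤c′ p∣c
    where 1≤c′ = 1≤*⇒1≤ˡ c 1≤n
  ...   | m , s , p∤m , refl = m , suc s , p∤m , regroup m (p ^ suc s) p
    where
    regroup : ∀ m x p → m ℕ.* x ℕ.* p ≡ m ℕ.* (p ℕ.* x)
    regroup = NS.solve-∀

prime-power-split : ∀ n → 2 ≤ n → PrimePowerSplit n
prime-power-split n 2≤n with prime-divisor n 2≤n
... | p , p-prime , p∣n with p-adic-split p-prime n (ℕP.<⇒≤ 2≤n) p∣n
...   | m , s , p∤m , refl = split p-prime m s p∤m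

prime-power-induction : (P : ℕ → Set) → P 1 →
                        (∀ {n} → 1 ≤ n → PrimePowerSplit n → (∀ {y} → y < n → 1 ≤ y → P y) → P n) →
                        ∀ n → 1 ≤ n → P n
prime-power-induction P base step = <-rec (λ n → 1 ≤ n → P n) go
  where
  go : ∀ n → (∀ {y} → y < n → 1 ≤ y → P y) → 1 ≤ n → P n
  go 1                _  _   = base
  go n@(suc (suc _)) IH 1≤n = step 1≤n (prime-power-split n (s≤s (s≤s z≤n))) IH

^-∣-from-prime-powers : ∀ k {X} n → 1 ≤ n →
                        (∀ {p} → Prime p → ∀ m s → ¬ p ∣ m → m ℕ.* p ^ suc s ≡ n → p ^ (suc s ℕ.* k) ∣ X) →
                        n ^ k ∣ X
^-∣-from-prime-powers k {X} = prime-power-induction (λ n → PrimePowerParts∣ n → n ^ k ∣ X) base step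
  where
  PrimePowerParts∣ : ℕ → Set
  PrimePowerParts∣ n = ∀ {p} → Prime p → ∀ m s → ¬ p ∣ m → m ℕ.* p ^ suc s ≡ n → p ^ (suc s ℕ.* k) ∣ X
  base : PrimePowerParts∣ 1 → 1 ^ k ∣ X
  base _ = subst (_∣ X) (sym (ℕP.^-zeroˡ k)) (ℕD.1∣ X)
  step : ∀ {n} → 1 ≤ n → PrimePowerSplit n → (∀ {y} → y < n → 1 ≤ y → PrimePowerParts∣ y → y ^ k ∣ X) →
         PrimePowerParts∣ n → n ^ k ∣ X
  step 1≤n (split {p} p-prime m s p∤m) IH parts =
    subst (_∣ X) (sym ([m*p^r]^k≡m^k*p^[r*k] m p (suc s) k))
      (*-p^-∣ p-prime (suc s ℕ.* k) (∤-^ p-prime p∤m k) (IH (m<m*p^suc p-prime s 1≤m) 1≤m parts-of-m) (parts p-prime m s p∤m refl))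
    where
    1≤m : 1 ≤ m
    1≤m = 1≤*⇒1≤ˡ m 1≤n
    parts-of-m : PrimePowerParts∣ m
    parts-of-m {q} q-prime m′ s′ q∤m′ m′q^s′≡m =
      parts q-prime (m′ ℕ.* p ^ suc s) s′ q∤m′p^s (trans (sym regroup) (cong (ℕ._* p ^ suc s) m′q^s′≡m))
      where
      q∣m : q ∣ m
      q∣m = subst (q ∣_) m′q^s′≡m (ℕD.∣n⇒∣m*n m′ (ℕD.m∣m*n (q ^ s′)))
      q∤p : ¬ q ∣ p
      q∤p q∣p with prime⇒irreducible p-prime q∣p
      ... | inj₁ refl = ℕP.<-irrefl refl (1<p q-prime)
      ... | inj₂ refl = p∤m q∣m
      q∤m′p^s : ¬ q ∣ m′ ℕ.* p ^ suc s
      q∤m′p^s q∣ = [ q∤m′ , ∤-^ q-prime q∤p (suc s) ]′ (euclidsLemma m′ (p ^ suc s) q-prime q∣)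
      regroup : m′ ℕ.* q ^ suc s′ ℕ.* p ^ suc s ≡ m′ ℕ.* p ^ suc s ℕ.* q ^ suc s′
      regroup = trans (ℕP.*-assoc m′ _ _) (trans (cong (m′ ℕ.*_) (ℕP.*-comm (q ^ suc s′) (p ^ suc s))) (sym (ℕP.*-assoc m′ _ _)))

-- Möbius inversion

Σ∣-μ⋆ : ∀ N → 1 ≤ N → ∀ A → Σ∣ N (μ⋆ A) ≡ A N
Σ∣-μ⋆ = prime-power-induction (λ N → ∀ A → Σ∣ N (μ⋆ A) ≡ A N) base step
  where
  base : ∀ A → Σ∣ 1 (μ⋆ A) ≡ A 1
  base A = trans (ℤP.+-identityʳ _) (trans (ℤP.+-identityʳ _) (ℤP.*-identityˡ (A 1)))
  step : ∀ {N} → 1 ≤ N → PrimePowerSplit N → (∀ {y} → y < N → 1 ≤ y → ∀ A → Σ∣ y (μ⋆ A) ≡ A y) →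
         ∀ A → Σ∣ N (μ⋆ A) ≡ A N
  step 1≤N (split {p} p-prime m s p∤m) IH A = begin
    Σ∣ (m ℕ.* q) (μ⋆ A)                                   ≡⟨ Σ∣-*p^suc p-prime p∤m 1≤m s (μ⋆ A) ⟩
    Σ∣ (m ℕ.* p ^ s) (μ⋆ A) + Σ∣ m (λ e → μ⋆ A (e ℕ.* q))  ≡⟨ cong₂ _+_ (IH (m*p^s<m*p^suc p-prime s 1≤m) 1≤mp^s A)
                                                                    (Σ∣-cong m λ e e∣m → μ⋆-*p^suc p-prime (1≤e e∣m) (p∤e e∣m) s A) ⟩
    A (m ℕ.* p ^ s) + Σ∣ m (μ⋆ A′)                        ≡⟨ cong (λ x → A (m ℕ.* p ^ s) + x) (IH (m<m*p^suc p-prime s 1≤m) 1≤m A′) ⟩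
    A (m ℕ.* p ^ s) + (A (m ℕ.* q) - A (m ℕ.* p ^ s))     ≡⟨ telescope (A (m ℕ.* p ^ s)) (A (m ℕ.* q)) ⟩
    A (m ℕ.* q)                                           ∎
    where
    open ≡-Reasoning
    q = p ^ suc s
    A′ : ℕ → ℤ
    A′ f = A (f ℕ.* q) - A (f ℕ.* p ^ s)
    1≤m : 1 ≤ m
    1≤m = 1≤*⇒1≤ˡ m 1≤N
    1≤mp^s : 1 ≤ m ℕ.* p ^ s
    1≤mp^s = 1≤*p^ p-prime s 1≤m
    1≤e : ∀ {e} → e ∣ m → 1 ≤ e
    1≤e (divides c refl) = 1≤*⇒1≤ʳ c 1≤m
    p∤e : ∀ {e} → e ∣ m → ¬ p ∣ e
    p∤e e∣m p∣e = p∤m (ℕD.∣-trans p∣e e∣m)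
    telescope : ∀ a b → a + (b - a) ≡ b
    telescope = solve-∀

μ⋆-p-difference : ∀ {p} → Prime p → ∀ {m} → ¬ p ∣ m → 1 ≤ m → ∀ s A →
                  A (m ℕ.* p ^ suc s) - A (m ℕ.* p ^ s) ≡ Σ∣ m (λ e → μ⋆ A (e ℕ.* p ^ suc s))
μ⋆-p-difference {p} p-prime {m} p∤m 1≤m s A = begin
  A (m ℕ.* p ^ suc s) - A (m ℕ.* p ^ s)
    ≡⟨ cong₂ _-_ (sym (Σ∣-μ⋆ _ (1≤*p^ p-prime (suc s) 1≤m) A)) (sym (Σ∣-μ⋆ _ (1≤*p^ p-prime s 1≤m) A)) ⟩
  Σ∣ (m ℕ.* p ^ suc s) (μ⋆ A) - Σ∣ (m ℕ.* p ^ s) (μ⋆ A)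
    ≡⟨ cong (_- Σ∣ (m ℕ.* p ^ s) (μ⋆ A)) (Σ∣-*p^suc p-prime p∤m 1≤m s (μ⋆ A)) ⟩
  Σ∣ (m ℕ.* p ^ s) (μ⋆ A) + Σ∣ m (λ e → μ⋆ A (e ℕ.* p ^ suc s)) - Σ∣ (m ℕ.* p ^ s) (μ⋆ A)
    ≡⟨ cancel (Σ∣ (m ℕ.* p ^ s) (μ⋆ A)) _ ⟩
  Σ∣ m (λ e → μ⋆ A (e ℕ.* p ^ suc s)) ∎
  where
  open ≡-Reasoning
  cancel : ∀ a b → a + b - a ≡ b
  cancel = solve-∀

-- (i) ⇔ (ii)

IntegerRealizable : ℕ → (ℕ → ℤ) → Set
IntegerRealizable k A = ∀ n → 1 ≤ n → + (n ^ k) ℤD.∣ μ⋆ A n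

integerRealizable⇒congruences : ∀ k A → IntegerRealizable k A → Congruences k A
integerRealizable⇒congruences k A realizable p (suc s) m p-prime _ 1≤m gcd≡1 =
  ℤD.∣⇒∣ᵤ (subst (+ (p ^ (suc s ℕ.* k)) ℤD.∣_) (sym (μ⋆-p-difference p-prime p∤m 1≤m s A))
            (Σ∣-divisible m _ _ λ e e∣m → ℤD.∣-trans (p^[r*k]∣[e*p^r]^k e p (suc s) k) (realizable _ (1≤e*p^suc e∣m))))
  where
  p∤m : ¬ p ∣ m
  p∤m p∣m = ℕP.<-irrefl (sym (gcd≡1⇒coprime gcd≡1 (p∣m , ℕD.∣-refl))) (1<p p-prime)
  1≤e*p^suc : ∀ {e} → e ∣ m → 1 ≤ e ℕ.* p ^ suc s
  1≤e*p^suc (divides c refl) = 1≤*p^ p-prime (suc s) (1≤*⇒1≤ʳ c 1≤m)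

congruence⇒top-divisible : ∀ k A → Congruences k A → ∀ {p} → Prime p → ∀ m s → ¬ p ∣ m → 1 ≤ m →
                           (∀ e → e ∣ m → e < m → + ((e ℕ.* p ^ suc s) ^ k) ℤD.∣ μ⋆ A (e ℕ.* p ^ suc s)) →
                           + (p ^ (suc s ℕ.* k)) ℤD.∣ μ⋆ A (m ℕ.* p ^ suc s)
congruence⇒top-divisible k A congruent {p} p-prime (suc m) s p∤m 1≤m proper-divisible =
  ℤD.∣m+n∣m⇒∣n whole (sumTo-divisible m c _ λ e _ e≤m → proper e e≤m)
  where
  c = + (p ^ (suc s ℕ.* k))
  whole : c ℤD.∣ sumTo m (λ e → when (e ∣? suc m) (μ⋆ A (e ℕ.* p ^ suc s))) + μ⋆ A (suc m ℕ.* p ^ suc s)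
  whole = subst (c ℤD.∣_) (trans (μ⋆-p-difference p-prime p∤m 1≤m s A) (Σ∣-last m _))
            (ℤD.∣ᵤ⇒∣ (congruent p (suc s) (suc m) p-prime (s≤s z≤n) 1≤m (coprime⇒gcd≡1 (∤⇒coprime p-prime p∤m))))
  proper : ∀ e → e ≤ m → c ℤD.∣ when (e ∣? suc m) (μ⋆ A (e ℕ.* p ^ suc s))
  proper e e≤m with e ∣? suc m
  ... | no  _   = ℤD.divides (+ 0) refl
  ... | yes e∣m = ℤD.∣-trans (p^[r*k]∣[e*p^r]^k e p (suc s) k)
                             (proper-divisible e e∣m (s≤s e≤m))

congruences⇒integerRealizable : ∀ k A → Congruences k A → IntegerRealizable k A
congruences⇒integerRealizable k A congruent = <-rec (λ n → 1 ≤ n → + (n ^ k) ℤD.∣ μ⋆ A n) step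
  where
  step : ∀ n → (∀ {y} → y < n → 1 ≤ y → + (y ^ k) ℤD.∣ μ⋆ A y) → 1 ≤ n → + (n ^ k) ℤD.∣ μ⋆ A n
  step n IH 1≤n = ℤD.∣ᵤ⇒∣ (^-∣-from-prime-powers k n 1≤n part)
    where
    part : ∀ {p} → Prime p → ∀ m s → ¬ p ∣ m → m ℕ.* p ^ suc s ≡ n → p ^ (suc s ℕ.* k) ∣ ℤ.∣ μ⋆ A n ∣
    part {p} p-prime m s p∤m refl = ℤD.∣⇒∣ᵤ (congruence⇒top-divisible k A congruent p-prime m s p∤m 1≤m
      λ e e∣m e<m → IH (ℕP.*-monoˡ-< (p ^ suc s) {{ℕP.m^n≢0 p (suc s) {{prime⇒nonZero p-prime}}}} e<m)
                       (1≤*p^ p-prime (suc s) (1≤e e∣m)))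
      where
      1≤m : 1 ≤ m
      1≤m = 1≤*⇒1≤ˡ m 1≤n
      1≤e : ∀ {e} → e ∣ m → 1 ≤ e
      1≤e (divides c refl) = 1≤*⇒1≤ʳ c 1≤m

-- (i) ⇔ (iii)

toℚᵘ-divℚ : ∀ x Q .{{_ : NonZero Q}} → toℚᵘ (x divℚ Q) ≃ᵘ x /ᵘ Q
toℚᵘ-divℚ x (suc d) = ℚP.toℚᵘ-fromℚᵘ (mkℚᵘ x d)

/ᵘ-≃⇔ : ∀ a b P Q .{{_ : NonZero P}} .{{_ : NonZero Q}} → a /ᵘ P ≃ᵘ b /ᵘ Q ⇔ a * + Q ≡ b * + P
/ᵘ-≃⇔ a b (suc P) (suc Q) = mk⇔ (λ { (*≡* eq) → eq }) *≡*

divℚ-≡⇔ : ∀ a b P Q .{{_ : NonZero P}} .{{_ : NonZero Q}} → a divℚ P ≡ b divℚ Q ⇔ a * + Q ≡ b * + P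
divℚ-≡⇔ a b P Q = mk⇔
  (λ eq → Equivalence.to (/ᵘ-≃⇔ a b P Q) (≃ᵘ-trans (≃ᵘ-sym (toℚᵘ-divℚ a P)) (≃ᵘ-trans (ℚP.toℚᵘ-cong eq) (toℚᵘ-divℚ b Q))))
  (λ eq → ℚP.toℚᵘ-injective (≃ᵘ-trans (toℚᵘ-divℚ a P) (≃ᵘ-trans (Equivalence.from (/ᵘ-≃⇔ a b P Q) eq) (≃ᵘ-sym (toℚᵘ-divℚ b Q)))))

toℚᵘ-sumℚ : ∀ (F : ℕ → ℚ) (G : ℕ → ℤ) Q .{{_ : NonZero Q}} → (∀ x → toℚᵘ (F x) ≃ᵘ G x /ᵘ Q) →
            ∀ xs → toℚᵘ (sumℚ (map F xs)) ≃ᵘ sumℤ (map G xs) /ᵘ Q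
toℚᵘ-sumℚ F G Q@(suc _) F≃G []       = *≡* refl
toℚᵘ-sumℚ F G Q@(suc _) F≃G (x ∷ xs) =
  ≃ᵘ-trans (ℚP.toℚᵘ-homo-+ (F x) (sumℚ (map F xs))) (≃ᵘ-trans (ℚᵘP.+-cong (F≃G x) (toℚᵘ-sumℚ F G Q F≃G xs)) (/ᵘ-+ (G x) _))
  where
  /ᵘ-+ : ∀ a b → a /ᵘ Q +ᵘ b /ᵘ Q ≃ᵘ (a + b) /ᵘ Q
  /ᵘ-+ a b = *≡* (trans (regroup a b (+ Q)) (cong ((a + b) *_) (sym (ℤP.pos-* Q Q))))
    where
    regroup : ∀ a b x → (a * x + b * x) * x ≡ (a + b) * (x * x)
    regroup = solve-∀

cross-multiplied : ∀ B c j k {N} → N ≡ c ℕ.* j → B * + 1 * + (N ^ k) ≡ + (j ^ k) * B * + (1 ℕ.* c ^ k)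
cross-multiplied B c j k refl = begin
  B * + 1 * + ((c ℕ.* j) ^ k)              ≡⟨ cong (λ x → B * + 1 * + x) (^-distribʳ-* c j k) ⟩
  B * + 1 * + (c ^ k ℕ.* j ^ k)            ≡⟨ cong (λ x → B * + 1 * x) (ℤP.pos-* (c ^ k) (j ^ k)) ⟩
  B * + 1 * (+ (c ^ k) * + (j ^ k))        ≡⟨ regroup B (+ (c ^ k)) (+ (j ^ k)) ⟩
  + (j ^ k) * B * + (c ^ k)                ≡⟨ cong (λ x → + (j ^ k) * B * + x) (sym (ℕP.*-identityˡ (c ^ k))) ⟩
  + (j ^ k) * B * + (1 ℕ.* c ^ k)          ∎
  where
  open ≡-Reasoning
  regroup : ∀ b x y → b * + 1 * (x * y) ≡ y * b * x
  regroup = solve-∀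

toℚᵘ-Li-term : ∀ k n (B : ℤ) j → toℚᵘ ((B ℚ./ 1) ℚ.* substPow j (Li k) (suc n))
                                  ≃ᵘ _/ᵘ_ (when (j ∣? suc n) (+ (j ^ k) * B)) (suc n ^ k) {{ℕP.m^n≢0 (suc n) k}}
toℚᵘ-Li-term k n B j with j ∣? suc n
... | no _ = ≃ᵘ-trans (ℚP.toℚᵘ-cong (ℚP.*-zeroʳ (B ℚ./ 1)))
                      (Equivalence.from (/ᵘ-≃⇔ (+ 0) (+ 0) 1 (suc n ^ k) {{_}} {{ℕP.m^n≢0 (suc n) k}}) refl)
... | yes (divides zero ())
... | yes (divides (suc c) N≡cj) = begin
  toℚᵘ ((B ℚ./ 1) ℚ.* Li k (suc n div j))          ≈⟨ ℚP.toℚᵘ-cong (cong (λ x → (B ℚ./ 1) ℚ.* Li k x) (div-cancel (suc c) j N≡cj)) ⟩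
  toℚᵘ ((B ℚ./ 1) ℚ.* Li k (suc c))                ≈⟨ ℚP.toℚᵘ-homo-* (B ℚ./ 1) (Li k (suc c)) ⟩
  toℚᵘ (B ℚ./ 1) *ᵘ toℚᵘ ((+ 1) divℚ (suc c ^ k))  ≈⟨ ℚᵘP.*-cong (toℚᵘ-divℚ B 1) (toℚᵘ-divℚ (+ 1) (suc c ^ k)) ⟩
  (B /ᵘ 1) *ᵘ ((+ 1) /ᵘ (suc c ^ k))               ≈⟨ /ᵘ-* B (+ 1) 1 (suc c ^ k) ⟩
  (B * + 1) /ᵘ (1 ℕ.* suc c ^ k)                   ≈⟨ Equivalence.from (/ᵘ-≃⇔ _ _ _ (suc n ^ k)) (cross-multiplied B (suc c) j k N≡cj) ⟩
  (+ (j ^ k) * B) /ᵘ (suc n ^ k)                   ∎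
  where
  open ≃ᵘ-Reasoning
  instance
    j≢0 : NonZero j
    j≢0 = ℕ.>-nonZero (1≤*⇒1≤ʳ (suc c) (subst (1 ≤_) N≡cj (s≤s z≤n)))
    c^k≢0 : NonZero (suc c ^ k)
    c^k≢0 = ℕP.m^n≢0 (suc c) k
    1*c^k≢0 : NonZero (1 ℕ.* suc c ^ k)
    1*c^k≢0 = ℕP.m*n≢0 1 (suc c ^ k)
    N^k≢0 : NonZero (suc n ^ k)
    N^k≢0 = ℕP.m^n≢0 (suc n) k
  /ᵘ-* : ∀ a b P Q .{{_ : NonZero P}} .{{_ : NonZero Q}} → (a /ᵘ P) *ᵘ (b /ᵘ Q) ≃ᵘ _/ᵘ_ (a * b) (P ℕ.* Q) {{ℕP.m*n≢0 P Q}}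
  /ᵘ-* a b (suc P) (suc Q) = ℚᵘP.≃-refl

rhsSeries≡ : ∀ k B n → rhsSeries k B (suc n) ≡ Σ∣ (suc n) (λ j → + (j ^ k) * B j) divℚ (suc n ^ k)
rhsSeries≡ k B n = ℚP.toℚᵘ-injective (≃ᵘ-trans
  (toℚᵘ-sumℚ _ (λ j → when (j ∣? suc n) (+ (j ^ k) * B j)) (suc n ^ k) (λ j → toℚᵘ-Li-term k n (B j) j) (range1 (suc n)))
  (≃ᵘ-trans (ℚᵘP.≃-reflexive (cong (_/ᵘ (suc n ^ k)) (sym (sumℤ-map-filter (_∣? suc n) (range1 (suc n)) _))))
            (≃ᵘ-sym (toℚᵘ-divℚ _ (suc n ^ k)))))
  where
  instance
    N^k≢0 : NonZero (suc n ^ k)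
    N^k≢0 = ℕP.m^n≢0 (suc n) k

realizable⇔integerRealizable : ∀ k A → Realizable k A ⇔ IntegerRealizable k A
realizable⇔integerRealizable k A = mk⇔ (λ realizable n 1≤n → to n 1≤n (realizable n 1≤n)) (λ integral n 1≤n → from n 1≤n (integral n 1≤n))
  where
  module _ n (1≤n : 1 ≤ n) where
    instance
      n^k≢0 : NonZero (n ^ k)
      n^k≢0 = ℕP.m^n≢0 n k {{ℕ.>-nonZero 1≤n}}
    to : Σ ℤ (λ z → Bseq k A n ≡ z ℚ./ 1) → + (n ^ k) ℤD.∣ μ⋆ A n
    to (z , Bₙ≡z) = ℤD.divides z (trans (sym (ℤP.*-identityʳ _)) (Equivalence.to (divℚ-≡⇔ _ z _ 1) Bₙ≡z))
    from : + (n ^ k) ℤD.∣ μ⋆ A n → Σ ℤ (λ z → Bseq k A n ≡ z ℚ./ 1)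
    from (ℤD.divides z μ⋆Aₙ≡) = z , Equivalence.from (divℚ-≡⇔ _ z _ 1) (trans (ℤP.*-identityʳ _) μ⋆Aₙ≡)

coefficient⇔ : ∀ k A B n → lhsSeries k A (suc n) ≡ rhsSeries k B (suc n) ⇔ A (suc n) ≡ Σ∣ (suc n) (λ j → + (j ^ k) * B j)
coefficient⇔ k A B n = mk⇔
  (λ eq → ℤP.*-cancelʳ-≡ _ _ (+ (suc n ^ k)) (Equivalence.to (divℚ-≡⇔ _ _ (suc n ^ k) (suc n ^ k)) (trans eq (rhsSeries≡ k B n))))
  (λ eq → trans (Equivalence.from (divℚ-≡⇔ _ _ (suc n ^ k) (suc n ^ k)) (cong (_* + (suc n ^ k)) eq)) (sym (rhsSeries≡ k B n)))
  where
  instance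
    N^k≢0 : NonZero (suc n ^ k)
    N^k≢0 = ℕP.m^n≢0 (suc n) k

integerRealizable⇔liExpansion : ∀ k A → IntegerRealizable k A ⇔ LiExpansion k A
integerRealizable⇔liExpansion k A = mk⇔ to from
  where
  to : IntegerRealizable k A → LiExpansion k A
  to integral = B , coefficients
    where
    B : ℕ → ℤ
    B zero    = + 0
    B (suc n) = ℤD._∣_.quotient (integral (suc n) (s≤s z≤n))
    μ⋆A≡ : ∀ {N} j → j ∣ suc N → μ⋆ A j ≡ + (j ^ k) * B j
    μ⋆A≡ zero    0∣ = ⊥-elim (ℕ.≢-nonZero⁻¹ _ (ℕD.0∣⇒≡0 0∣))
    μ⋆A≡ (suc j) _  = trans (ℤD._∣_.equality (integral (suc j) (s≤s z≤n))) (ℤP.*-comm (B (suc j)) _)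
    coefficients : ∀ N → lhsSeries k A N ≡ rhsSeries k B N
    coefficients zero    = refl
    coefficients (suc n) = Equivalence.from (coefficient⇔ k A B n) (trans (sym (Σ∣-μ⋆ (suc n) (s≤s z≤n) A)) (Σ∣-cong (suc n) μ⋆A≡))
  from : LiExpansion k A → IntegerRealizable k A
  from (B , coefficients) n 1≤n =
    ℤD.divides (B n) (trans (Σ∣-injective (μ⋆ A) (λ j → + (j ^ k) * B j) Σ∣-agree n 1≤n) (ℤP.*-comm (+ (n ^ k)) (B n)))
    where
    Σ∣-agree : ∀ N → 1 ≤ N → Σ∣ N (μ⋆ A) ≡ Σ∣ N (λ j → + (j ^ k) * B j)
    Σ∣-agree (suc N) _ = trans (Σ∣-μ⋆ (suc N) (s≤s z≤n) A) (Equivalence.to (coefficient⇔ k A B N) (coefficients (suc N)))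

-- The argument works for every k.
proposition11 : (k : ℕ) → 1 ≤ k → (A : ℕ → ℤ) →
    (Realizable k A ⇔ Congruences k A) × (Realizable k A ⇔ LiExpansion k A)
proposition11 k _ A =
  ⇔.trans (realizable⇔integerRealizable k A) (mk⇔ (integerRealizable⇒congruences k A) (congruences⇒integerRealizable k A)) ,
  ⇔.trans (realizable⇔integerRealizable k A) (integerRealizable⇔liExpansion k A)
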